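{- Let $n,\ell$ be positive integers and let $\phi$ be the edge-coloring of $P_n^\ell$ described in the context. If $v_iv_j$ ($i<j$) is an edge of $P_n^\ell$ and $k$ is the largest entry of its window $(c_{i+1},\dots,c_j)$, then $\phi(v_iv_j)=\phi(v_{i'}v_{j'})$ for some edge $v_{i'}v_{j'}$ of $P_n^\ell$ with $j'=2^{k-1}$ and $j'-\ell\le i'<j'$.
   Context: Let $c_i=1+t$ for $i\ge1$, where $2^t$ is the largest power of $2$ dividing $i$ (so $(c_i)$ begins $1,2,1,3,1,2,1,4,\dots$). Let $\mathbb{U}$ be the $\mathbb{F}_2$-vector space of binary sequences with finitely many $1$s and $e_j$ the vector whose only $1$ is in coordinate $j$. Put $a_i=e_{c_i}$ and $s_i=a_1+\cdots+a_i$ (with $s_0=0$). $P_n^\ell$ has vertices $v_0,\dots,v_{n-1}$, with $v_iv_j$ an edge iff $1\le|i-j|\le\ell$. The edge-coloring $\phi$ of $P_n^\ell$ is $\phi(v_iv_j)=s_i+s_j$, which for $i<j$ equals $a_{i+1}+\cdots+a_j$; the window corresponding to the edge $v_iv_j$ ($i<j$) is $(c_{i+1},\dots,c_j)$. -}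

module Defs where

open import Data.Nat using (ℕ; zero; suc; _+_; _≡ᵇ_; ⌊_/2⌋)
open import Data.Bool using (Bool; true; false; if_then_else_; _xor_)

isEven : ℕ → Bool
isEven zero = true
isEven (suc zero) = false
isEven (suc (suc n)) = isEven n

v2aux : ℕ → ℕ → ℕ
v2aux zero _ = zero
v2aux (suc f) zero = zero
v2aux (suc f) (suc i) = if isEven (suc i) then suc (v2aux f ⌊ suc i /2⌋) else zero

-- v2 i = t where 2^t is the largest power of 2 dividing i (i ≥ 1); fuel i suffices.
v2 : ℕ → ℕ
v2 i = v2aux i i

c : ℕ → ℕ
c i = suc (v2 i)

-- Elements of 𝕌 are represented by their coordinate functions ℕ → Bool
-- (coordinate 0 is never used; coordinates are 1,2,3,...). Addition in 𝕌 is
-- pointwise xor.  a i = e_{c i}.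
a : ℕ → ℕ → Bool
a i x = c i ≡ᵇ x

s : ℕ → ℕ → Bool
s zero x = false
s (suc i) x = s i x xor a (suc i) x

φ : ℕ → ℕ → ℕ → Bool
φ i j x = s i x xor s j x

_≡𝕌_ : (ℕ → Bool) → (ℕ → Bool) → Set
u ≡𝕌 w = ∀ x → u x ≡ w x
  where open import Relation.Binary.PropositionalEquality using (_≡_)

module Submission where

-- The coloring s_i is the binary reflected Gray code of i, so s_(u xor w) =
-- s_u + s_w.  If the maximum k of the window is attained at m = 2^(k-1) (2q+1),
-- then no multiple of 2^k lies in the window (c exceeds k there), so with
-- A = 2^k q we get i = A + u and j = A + 2^(k-1) + w for some u, w < 2^(k-1).
-- Hence s_i + s_j = s_u + s_w + s_(2^(k-1)) = s_x + s_(2^(k-1)) with x = u xor w,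
-- and u ≤ x + w turns j - i ≤ ℓ into 2^(k-1) ≤ x + ℓ.

open import Defs
open import Data.Nat using (ℕ; zero; suc; _+_; _*_; _∸_; _^_; _≤_; _<_; _≡ᵇ_; ⌊_/2⌋; z≤n; s≤s; z<s; s<s)
open import Data.Nat.Properties
open import Data.Bool using (Bool; true; false; not; _xor_)
open import Algebra.Bundles using (CommutativeRing)
open import Data.Bool.Properties using (xor-∧-commutativeRing; xor-same; xor-identityʳ; xor-comm; not-involutive)
open import Relation.Binary.PropositionalEquality
open import Function using (_∘_)
open import Data.Nat.Tactic.RingSolver using (solve-∀)
open import Algebra.Properties.CommutativeSemigroup
  (CommutativeRing.+-commutativeSemigroup xor-∧-commutativeRing)
  using () renaming (interchange to xor-interchange; x∙yz≈xz∙y to xor-rotate)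
open import Data.Product using (_×_; ∃; ∃-syntax; _,_)
open import Data.Empty using (⊥)

bit : Bool → ℕ
bit false = 0
bit true  = 1

infixr 5 _∷₂_

_∷₂_ : Bool → ℕ → ℕ
b ∷₂ y = bit b + (y + y)

false∷₂suc : ∀ y → false ∷₂ suc y ≡ suc (true ∷₂ y)
false∷₂suc y = cong suc (+-suc y y)

data LowestBit : ℕ → Set where
  lowest : ∀ b y → LowestBit (b ∷₂ y)

lowestBit : ∀ x → LowestBit x
lowestBit zero = lowest false 0
lowestBit (suc x) with lowestBit x
... | lowest false y = lowest true y
... | lowest true  y = subst LowestBit (false∷₂suc y) (lowest false (suc y))

odd : ℕ → Bool
odd n = not (isEven n)

isEven-suc : ∀ n → isEven (suc n) ≡ not (isEven n)
isEven-suc zero    = refl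
isEven-suc (suc n) = trans (sym (not-involutive _)) (cong not (sym (isEven-suc n)))

isEven-double : ∀ y → isEven (y + y) ≡ true
isEven-double zero    = refl
isEven-double (suc y) = trans (cong (isEven ∘ suc) (+-suc y y)) (isEven-double y)

isEven-∷₂ : ∀ b y → isEven (b ∷₂ y) ≡ not b
isEven-∷₂ false y = isEven-double y
isEven-∷₂ true  y = trans (isEven-suc (y + y)) (cong not (isEven-double y))

odd-∷₂ : ∀ b y → odd (b ∷₂ y) ≡ b
odd-∷₂ b y = trans (cong not (isEven-∷₂ b y)) (not-involutive b)

v2aux-fuel : ∀ f g x → x ≤ f → x ≤ g → v2aux f x ≡ v2aux g x
v2aux-fuel f       g       zero    _         _ = trans (v2aux-zero f) (sym (v2aux-zero g))
  where
  v2aux-zero : ∀ f → v2aux f 0 ≡ 0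
  v2aux-zero zero    = refl
  v2aux-zero (suc f) = refl
v2aux-fuel (suc f) (suc g) (suc x) (s≤s x≤f) (s≤s x≤g) with isEven (suc x)
... | false = refl
... | true  = cong suc (v2aux-fuel f g ⌊ suc x /2⌋ (half≤ x≤f) (half≤ x≤g))
  where
  half≤ : ∀ {h} → x ≤ h → ⌊ suc x /2⌋ ≤ h
  half≤ x≤h = ≤-trans (≤-pred (⌊n/2⌋<n x)) x≤h

v2-even : ∀ x → isEven (suc x) ≡ true → v2 (suc x) ≡ suc (v2 ⌊ suc x /2⌋)
v2-even x even rewrite even =
  cong suc (v2aux-fuel x ⌊ suc x /2⌋ ⌊ suc x /2⌋ (≤-pred (⌊n/2⌋<n x)) ≤-refl)

c-true∷₂ : ∀ y → c (true ∷₂ y) ≡ 1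
c-true∷₂ y rewrite isEven-∷₂ true y = refl

c-false∷₂ : ∀ y → 0 < y → c (false ∷₂ y) ≡ suc (c y)
c-false∷₂ (suc y) _ = begin
  suc (v2 (suc y + suc y))               ≡⟨ cong suc (v2-even (y + suc y) (isEven-double (suc y))) ⟩
  suc (suc (v2 ⌊ suc y + suc y /2⌋))     ≡⟨ cong (λ z → suc (suc (v2 z))) (n≡⌊n+n/2⌋ (suc y)) ⟨
  suc (suc (v2 (suc y)))                 ∎
  where open ≡-Reasoning

s-zeroth : ∀ x → s x 0 ≡ false
s-zeroth zero    = refl
s-zeroth (suc x) = trans (xor-identityʳ (s x 0)) (s-zeroth x)

s-false∷₂-suc : ∀ y t → s (false ∷₂ suc y) t ≡ s (true ∷₂ y) t xor (c (false ∷₂ suc y) ≡ᵇ t)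
s-false∷₂-suc y t =
  subst (λ z → s z t ≡ s (true ∷₂ y) t xor (c z ≡ᵇ t)) (sym (false∷₂suc y)) refl

s-∷₂-shift : ∀ b y t → s (b ∷₂ y) (suc (suc t)) ≡ s y (suc t)
s-double-shift : ∀ y t → s (y + y) (suc (suc t)) ≡ s y (suc t)

s-∷₂-shift false y t = s-double-shift y t
s-∷₂-shift true  y t = begin
  s (y + y) (suc (suc t)) xor (c (true ∷₂ y) ≡ᵇ suc (suc t))
    ≡⟨ cong₂ _xor_ (s-double-shift y t) (cong (_≡ᵇ suc (suc t)) (c-true∷₂ y)) ⟩
  s y (suc t) xor false
    ≡⟨ xor-identityʳ (s y (suc t)) ⟩
  s y (suc t)
    ∎
  where open ≡-Reasoning

s-double-shift zero    t = refl
s-double-shift (suc y) t = begin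
  s (false ∷₂ suc y) (suc (suc t))
    ≡⟨ s-false∷₂-suc y (suc (suc t)) ⟩
  s (true ∷₂ y) (suc (suc t)) xor (c (false ∷₂ suc y) ≡ᵇ suc (suc t))
    ≡⟨ cong₂ _xor_ (s-∷₂-shift true y t) (cong (_≡ᵇ suc (suc t)) (c-false∷₂ (suc y) z<s)) ⟩
  s (suc y) (suc t)
    ∎
  where open ≡-Reasoning

s-∷₂-first : ∀ b y → s (b ∷₂ y) 1 ≡ b xor odd y
s-double-first : ∀ y → s (y + y) 1 ≡ odd y

s-∷₂-first false y = s-double-first y
s-∷₂-first true  y = begin
  s (y + y) 1 xor (c (true ∷₂ y) ≡ᵇ 1)
    ≡⟨ cong₂ _xor_ (s-double-first y) (cong (_≡ᵇ 1) (c-true∷₂ y)) ⟩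
  odd y xor true
    ≡⟨ xor-comm (odd y) true ⟩
  true xor odd y
    ∎
  where open ≡-Reasoning

s-double-first zero    = refl
s-double-first (suc y) = begin
  s (false ∷₂ suc y) 1
    ≡⟨ s-false∷₂-suc y 1 ⟩
  s (true ∷₂ y) 1 xor (c (false ∷₂ suc y) ≡ᵇ 1)
    ≡⟨ cong₂ _xor_ (s-∷₂-first true y) (cong (_≡ᵇ 1) (c-false∷₂ (suc y) z<s)) ⟩
  not (odd y) xor false
    ≡⟨ xor-identityʳ (not (odd y)) ⟩
  not (odd y)
    ≡⟨ cong not (isEven-suc y) ⟨
  odd (suc y)
    ∎
  where open ≡-Reasoning

-- z ≐ x ⊕ y: z behaves like the bitwise xor of x and y, as seen by the
-- coloring s and by the lowest bit.
infix 4 _≐_⊕_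

record _≐_⊕_ (z x y : ℕ) : Set where
  constructor xor-like
  field
    s-xor   : s z ≡𝕌 (λ t → s x t xor s y t)
    odd-xor : odd z ≡ odd x xor odd y

≐-zeroʳ : ∀ z → z ≐ z ⊕ 0
≐-zeroʳ z = xor-like (λ t → sym (xor-identityʳ (s z t))) (sym (xor-identityʳ (odd z)))

∷₂-≐ : ∀ {z x y} a b → z ≐ x ⊕ y → (a xor b) ∷₂ z ≐ (a ∷₂ x) ⊕ (b ∷₂ y)
∷₂-≐ {z} {x} {y} a b (xor-like s-z odd-z) = xor-like s-∷₂ odd-∷₂-xor
  where
  open ≡-Reasoning
  s-∷₂ : s ((a xor b) ∷₂ z) ≡𝕌 λ t → s (a ∷₂ x) t xor s (b ∷₂ y) t
  s-∷₂ zero = begin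
    s ((a xor b) ∷₂ z) 0                ≡⟨ s-zeroth ((a xor b) ∷₂ z) ⟩
    false                               ≡⟨ cong₂ _xor_ (s-zeroth (a ∷₂ x)) (s-zeroth (b ∷₂ y)) ⟨
    s (a ∷₂ x) 0 xor s (b ∷₂ y) 0       ∎
  s-∷₂ (suc zero) = begin
    s ((a xor b) ∷₂ z) 1                ≡⟨ s-∷₂-first (a xor b) z ⟩
    (a xor b) xor odd z                 ≡⟨ cong ((a xor b) xor_) odd-z ⟩
    (a xor b) xor (odd x xor odd y)     ≡⟨ xor-interchange a b (odd x) (odd y) ⟩
    (a xor odd x) xor (b xor odd y)     ≡⟨ cong₂ _xor_ (s-∷₂-first a x) (s-∷₂-first b y) ⟨
    s (a ∷₂ x) 1 xor s (b ∷₂ y) 1       ∎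
  s-∷₂ (suc (suc t)) = begin
    s ((a xor b) ∷₂ z) (suc (suc t))    ≡⟨ s-∷₂-shift (a xor b) z t ⟩
    s z (suc t)                         ≡⟨ s-z (suc t) ⟩
    s x (suc t) xor s y (suc t)         ≡⟨ cong₂ _xor_ (s-∷₂-shift a x t) (s-∷₂-shift b y t) ⟨
    s (a ∷₂ x) (suc (suc t)) xor s (b ∷₂ y) (suc (suc t)) ∎
  odd-∷₂-xor : odd ((a xor b) ∷₂ z) ≡ odd (a ∷₂ x) xor odd (b ∷₂ y)
  odd-∷₂-xor = trans (odd-∷₂ (a xor b) z) (sym (cong₂ _xor_ (odd-∷₂ a x) (odd-∷₂ b y)))

bit≤1 : ∀ b → bit b ≤ 1
bit≤1 false = z≤n
bit≤1 true  = s≤s z≤n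

bit-≤-xor-+ : ∀ a b → bit a ≤ bit (a xor b) + bit b
bit-≤-xor-+ false b     = z≤n
bit-≤-xor-+ true  false = s≤s z≤n
bit-≤-xor-+ true  true  = s≤s z≤n

2^suc≡2^+2^ : ∀ p → 2 ^ suc p ≡ 2 ^ p + 2 ^ p
2^suc≡2^+2^ p = cong (2 ^ p +_) (+-identityʳ (2 ^ p))

∷₂-<-2^suc : ∀ p b {y} → y < 2 ^ p → b ∷₂ y < 2 ^ suc p
∷₂-<-2^suc p b {y} y<2^p = begin-strict
  b ∷₂ y              ≤⟨ +-monoˡ-≤ (y + y) (bit≤1 b) ⟩
  true ∷₂ y           <⟨ n<1+n (true ∷₂ y) ⟩
  suc (true ∷₂ y)     ≡⟨ false∷₂suc y ⟨
  suc y + suc y       ≤⟨ +-mono-≤ y<2^p y<2^p ⟩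
  2 ^ p + 2 ^ p       ≡⟨ 2^suc≡2^+2^ p ⟨
  2 ^ suc p           ∎
  where open ≤-Reasoning

∷₂-<-2^suc⁻¹ : ∀ p b y → b ∷₂ y < 2 ^ suc p → y < 2 ^ p
∷₂-<-2^suc⁻¹ p b y b∷₂y< = ≰⇒> λ 2^p≤y → <⇒≱ b∷₂y< (begin
  2 ^ suc p           ≡⟨ 2^suc≡2^+2^ p ⟩
  2 ^ p + 2 ^ p       ≤⟨ +-mono-≤ 2^p≤y 2^p≤y ⟩
  y + y               ≤⟨ m≤n+m (y + y) (bit b) ⟩
  b ∷₂ y              ∎)
  where open ≤-Reasoning

∷₂-≤-xor-+ : ∀ a b {u w x} → u ≤ x + w → a ∷₂ u ≤ ((a xor b) ∷₂ x) + (b ∷₂ w)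
∷₂-≤-xor-+ a b {u} {w} {x} u≤x+w = begin
  bit a + (u + u)                                 ≤⟨ +-mono-≤ (bit-≤-xor-+ a b) (+-mono-≤ u≤x+w u≤x+w) ⟩
  (bit (a xor b) + bit b) + ((x + w) + (x + w))   ≡⟨ regroup (bit (a xor b)) (bit b) x w ⟩
  (bit (a xor b) + (x + x)) + (bit b + (w + w))   ∎
  where
  open ≤-Reasoning
  regroup : ∀ γ β x w → (γ + β) + ((x + w) + (x + w)) ≡ (γ + (x + x)) + (β + (w + w))
  regroup = solve-∀

false∷₂-+-∷₂ : ∀ b x y → (false ∷₂ x) + (b ∷₂ y) ≡ b ∷₂ (x + y)
false∷₂-+-∷₂ b x y = lemma x y (bit b)
  where
  lemma : ∀ x y β → (x + x) + (β + (y + y)) ≡ β + ((x + y) + (x + y))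
  lemma = solve-∀

2^suc*≡false∷₂ : ∀ p q → 2 ^ suc p * q ≡ false ∷₂ (2 ^ p * q)
2^suc*≡false∷₂ p q = lemma (2 ^ p) q
  where
  lemma : ∀ P q → (2 * P) * q ≡ P * q + P * q
  lemma = solve-∀

low-bits-≐ : ∀ p q x → x < 2 ^ p → 2 ^ p * q + x ≐ 2 ^ p * q ⊕ x
low-bits-≐ zero    q zero    _ rewrite +-identityʳ (1 * q) = ≐-zeroʳ (1 * q)
low-bits-≐ zero    q (suc x) (s≤s ())
low-bits-≐ (suc p) q x x<2^p+1 with lowestBit x
... | lowest b y =
  subst₂ (λ z z′ → z ≐ z′ ⊕ (b ∷₂ y)) high-carry (sym (2^suc*≡false∷₂ p q))
    (∷₂-≐ false b (low-bits-≐ p q y (∷₂-<-2^suc⁻¹ p b y x<2^p+1)))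
  where
  high-carry : b ∷₂ (2 ^ p * q + y) ≡ 2 ^ suc p * q + (b ∷₂ y)
  high-carry = sym (trans (cong (_+ (b ∷₂ y)) (2^suc*≡false∷₂ p q)) (false∷₂-+-∷₂ b (2 ^ p * q) y))

bitwise-xor : ∀ p u w → u < 2 ^ p → w < 2 ^ p → ∃[ x ] (x < 2 ^ p × u ≤ x + w × x ≐ u ⊕ w)
bitwise-xor zero    zero    zero    _        _        = 0 , z<s , z≤n , ≐-zeroʳ 0
bitwise-xor zero    (suc u) _       (s≤s ()) _
bitwise-xor zero    zero    (suc w) _        (s≤s ())
bitwise-xor (suc p) u       w       u<2^p+1  w<2^p+1 with lowestBit u | lowestBit w
... | lowest a u′ | lowest b w′
  with x′ , x′<2^p , u′≤x′+w′ , x′≐u′⊕w′ ← bitwise-xor p u′ w′ (∷₂-<-2^suc⁻¹ p a u′ u<2^p+1) (∷₂-<-2^suc⁻¹ p b w′ w<2^p+1) =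
  (a xor b) ∷₂ x′ ,
  ∷₂-<-2^suc p (a xor b) x′<2^p ,
  ∷₂-≤-xor-+ a b {w = w′} {x = x′} u′≤x′+w′ ,
  ∷₂-≐ a b x′≐u′⊕w′

p<c[2^p*m] : ∀ p m → 0 < m → p < c (2 ^ p * m)
p<c[2^p*m] zero    m _   = z<s
p<c[2^p*m] (suc p) m 0<m = begin-strict
  suc p                       <⟨ s<s (p<c[2^p*m] p m 0<m) ⟩
  suc (c (2 ^ p * m))         ≡⟨ c-false∷₂ (2 ^ p * m) (*-mono-≤ (m^n>0 2 p) 0<m) ⟨
  c (false ∷₂ (2 ^ p * m))    ≡⟨ cong c (2^suc*≡false∷₂ p m) ⟨
  c (2 ^ suc p * m)           ∎
  where open ≤-Reasoning

c≡suc⇒odd-multiple : ∀ p m → 0 < m → c m ≡ suc p → ∃[ q ] m ≡ 2 ^ suc p * q + 2 ^ p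
c≡suc⇒odd-multiple p m 0<m cm≡1+p with lowestBit m
c≡suc⇒odd-multiple zero    _ _  _     | lowest true y = y , lemma y
  where
  lemma : ∀ y → suc (y + y) ≡ 2 * y + 1
  lemma = solve-∀
c≡suc⇒odd-multiple (suc p) _ _  cm≡1+p | lowest true y
  with () ← suc-injective (trans (sym (c-true∷₂ y)) cm≡1+p)
c≡suc⇒odd-multiple p       _ () _     | lowest false zero
c≡suc⇒odd-multiple zero    _ _  cm≡1+p | lowest false (suc y)
  with () ← suc-injective (trans (sym (c-false∷₂ (suc y) z<s)) cm≡1+p)
c≡suc⇒odd-multiple (suc p) _ _  cm≡1+p | lowest false (suc y)
  with q , y≡ ← c≡suc⇒odd-multiple p (suc y) z<s (suc-injective (trans (sym (c-false∷₂ (suc y) z<s)) cm≡1+p)) =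
  q , (begin
    false ∷₂ suc y                                        ≡⟨ cong (false ∷₂_) y≡ ⟩
    false ∷₂ (2 ^ suc p * q + 2 ^ p)                      ≡⟨ false∷₂-+-∷₂ false (2 ^ suc p * q) (2 ^ p) ⟨
    (false ∷₂ (2 ^ suc p * q)) + (false ∷₂ 2 ^ p)         ≡⟨ cong₂ _+_ (2^suc*≡false∷₂ (suc p) q) (2^suc≡2^+2^ p) ⟨
    2 ^ suc (suc p) * q + 2 ^ suc p                       ∎)
  where open ≡-Reasoning

no-multiple-in-window : ∀ {i j k} → (∀ t → i < t → t ≤ j → c t ≤ k) →
                        ∀ r → i < 2 ^ k * r → 2 ^ k * r ≤ j → ⊥
no-multiple-in-window {i} {k = k} c≤k zero    i<0 _ = n≮0 (subst (i <_) (*-zeroʳ (2 ^ k)) i<0)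
no-multiple-in-window {k = k} c≤k (suc r) i<t t≤j =
  <⇒≱ (p<c[2^p*m] k (suc r) z<s) (c≤k _ i<t t≤j)

window-split : ∀ {i j m p} → (∀ t → i < t → t ≤ j → c t ≤ suc p) → i < m → m ≤ j → c m ≡ suc p →
               ∃[ q ] ∃[ u ] ∃[ w ] (u < 2 ^ p × w < 2 ^ p ×
                                     i ≡ 2 ^ suc p * q + u × j ≡ 2 ^ suc p * q + (2 ^ p + w))
window-split {i} {j} {m} {p} c≤1+p i<m m≤j cm≡1+p
  with q , refl ← c≡suc⇒odd-multiple p m (≤-<-trans z≤n i<m) cm≡1+p =
  q , u , w , u<P , w<P , sym A+u≡i , trans (sym A+P+w≡j) (+-assoc A P w)
  where
  A = 2 ^ suc p * q
  P = 2 ^ p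
  u = i ∸ A
  w = j ∸ (A + P)
  A≤i : A ≤ i
  A≤i = ≮⇒≥ λ i<A → no-multiple-in-window c≤1+p q i<A (≤-trans (m≤m+n A P) m≤j)
  j<A+P+P : j < A + P + P
  j<A+P+P = ≰⇒> λ B≤j → no-multiple-in-window c≤1+p (suc q)
    (<-trans i<m (subst (A + P <_) next-block (m<m+n (A + P) (m^n>0 2 p))))
    (subst (_≤ j) next-block B≤j)
    where
    next-block : A + P + P ≡ 2 ^ suc p * suc q
    next-block = lemma P q
      where
      lemma : ∀ P q → (2 * P) * q + P + P ≡ (2 * P) * suc q
      lemma = solve-∀
  A+u≡i : A + u ≡ i
  A+u≡i = m+[n∸m]≡n A≤i
  A+P+w≡j : A + P + w ≡ j
  A+P+w≡j = m+[n∸m]≡n m≤j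
  u<P : u < P
  u<P = +-cancelˡ-< A u P (subst (_< A + P) (sym A+u≡i) i<m)
  w<P : w < P
  w<P = +-cancelˡ-< (A + P) w P (subst (_< A + P + P) (sym A+P+w≡j) j<A+P+P)

φ-block : ∀ p q {u w x} → u < 2 ^ p → w < 2 ^ p → x ≐ u ⊕ w →
          φ (2 ^ suc p * q + u) (2 ^ suc p * q + (2 ^ p + w)) ≡𝕌 φ x (2 ^ p)
φ-block p q {u} {w} {x} u<P w<P x≐u⊕w t = begin
  s (A + u) t xor s (A + (P + w)) t
    ≡⟨ cong₂ _xor_ (s-xor (low-bits-≐ (suc p) q u u<2P) t) (s-xor (low-bits-≐ (suc p) q (P + w) P+w<2P) t) ⟩
  (s A t xor s u t) xor (s A t xor s (P + w) t)
    ≡⟨ xor-interchange (s A t) (s u t) (s A t) (s (P + w) t) ⟩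
  (s A t xor s A t) xor (s u t xor s (P + w) t)
    ≡⟨ cong (_xor (s u t xor s (P + w) t)) (xor-same (s A t)) ⟩
  s u t xor s (P + w) t
    ≡⟨ cong (s u t xor_) (s-xor P+w≐P⊕w t) ⟩
  s u t xor (s P t xor s w t)
    ≡⟨ xor-rotate (s u t) (s P t) (s w t) ⟩
  (s u t xor s w t) xor s P t
    ≡⟨ cong (_xor s P t) (s-xor x≐u⊕w t) ⟨
  s x t xor s P t
    ∎
  where
  open ≡-Reasoning
  open _≐_⊕_ using (s-xor)
  A = 2 ^ suc p * q
  P = 2 ^ p
  u<2P : u < 2 ^ suc p
  u<2P = <-≤-trans u<P (≤-trans (m≤m+n P P) (≤-reflexive (sym (2^suc≡2^+2^ p))))
  P+w<2P : P + w < 2 ^ suc p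
  P+w<2P = <-≤-trans (+-monoʳ-< P w<P) (≤-reflexive (sym (2^suc≡2^+2^ p)))
  P+w≐P⊕w : P + w ≐ P ⊕ w
  P+w≐P⊕w = subst (λ P′ → P′ + w ≐ P′ ⊕ w) (*-identityʳ P) (low-bits-≐ p 1 w w<P)

lemma4p7 : (n ℓ : ℕ) → 1 ≤ n → 1 ≤ ℓ →
    (i j : ℕ) → i < j → j < n → j ≤ i + ℓ →
    (k : ℕ) →
    (∀ m → i < m → m ≤ j → c m ≤ k) →
    (∃[ m ] (i < m × m ≤ j × c m ≡ k)) →
    ∃[ i' ] (i' < 2 ^ (k ∸ 1) × 2 ^ (k ∸ 1) < n × 2 ^ (k ∸ 1) ≤ i' + ℓ
             × (φ i j ≡𝕌 φ i' (2 ^ (k ∸ 1))))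
lemma4p7 n ℓ _ _ i j _ j<n j≤i+ℓ .(c m) c≤k (m , i<m , m≤j , refl)
  with q , u , w , u<P , w<P , refl , refl ← window-split c≤k i<m m≤j refl
  with x , x<P , u≤x+w , x≐u⊕w ← bitwise-xor (v2 m) u w u<P w<P =
  x , x<P , P<n , P≤x+ℓ , φ-block (v2 m) q u<P w<P x≐u⊕w
  where
  A = 2 ^ suc (v2 m) * q
  P = 2 ^ v2 m
  P<n : P < n
  P<n = ≤-<-trans (≤-trans (m≤m+n P w) (m≤n+m (P + w) A)) j<n
  P+w≤x+ℓ+w : P + w ≤ (x + ℓ) + w
  P+w≤x+ℓ+w = begin
    P + w          ≤⟨ +-cancelˡ-≤ A (P + w) (u + ℓ) (subst (A + (P + w) ≤_) (+-assoc A u ℓ) j≤i+ℓ) ⟩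
    u + ℓ          ≤⟨ +-monoˡ-≤ ℓ u≤x+w ⟩
    (x + w) + ℓ    ≡⟨ swap-last x w ℓ ⟩
    (x + ℓ) + w    ∎
    where
    open ≤-Reasoning
    swap-last : ∀ x w ℓ → (x + w) + ℓ ≡ (x + ℓ) + w
    swap-last = solve-∀
  P≤x+ℓ : P ≤ x + ℓ
  P≤x+ℓ = +-cancelʳ-≤ w P (x + ℓ) P+w≤x+ℓ+w
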